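{- For a morphism $f$ in a wild category, the type $\mathrm{isCatIso}(f):=\mathrm{Sec}(f)\times\mathrm{Ret}(f)$ is a proposition.
   Context: Working in intensional Martin-Löf type theory (without function extensionality). A wild category has a type of objects, types of morphisms $\mathcal C(x,y)$, composition, identities, associator paths and left/right unitor paths. For $f:x\to y$, $\mathrm{Sec}(f):=\sum_{g:y\to x}f\circ g=\mathrm{id}_y$ and $\mathrm{Ret}(f):=\sum_{r:y\to x}r\circ f=\mathrm{id}_x$. A proposition is a type any two elements of which are equal. -}

{-# OPTIONS --without-K #-}
module Defs where

open import Level using (Level; _⊔_; suc)
open import Data.Product using (Σ; _×_)
open import Relation.Binary.PropositionalEquality using (_≡_)

isProp : ∀ {a} → Set a → Set a
isProp A = (x y : A) → x ≡ y

-- A wild category: objects, hom-types, composition, identities,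
-- associator and left/right unitor paths (no higher coherences,
-- hom-types are arbitrary types, not assumed to be sets).
record WildCat (o ℓ : Level) : Set (suc (o ⊔ ℓ)) where
  infixr 9 _∘_
  field
    Ob    : Set o
    Hom   : Ob → Ob → Set ℓ
    _∘_   : ∀ {x y z} → Hom y z → Hom x y → Hom x z
    id    : ∀ {x} → Hom x x
    assoc : ∀ {w x y z} (h : Hom y z) (g : Hom x y) (f : Hom w x) →
            (h ∘ g) ∘ f ≡ h ∘ (g ∘ f)
    idl   : ∀ {x y} (f : Hom x y) → id ∘ f ≡ f
    idr   : ∀ {x y} (f : Hom x y) → f ∘ id ≡ f

module _ {o ℓ} (C : WildCat o ℓ) where
  open WildCat C

  Sec : ∀ {x y} → Hom x y → Set ℓ
  Sec {x} {y} f = Σ (Hom y x) (λ g → f ∘ g ≡ id)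

  Ret : ∀ {x y} → Hom x y → Set ℓ
  Ret {x} {y} f = Σ (Hom y x) (λ r → r ∘ f ≡ id)

  isCatIso : ∀ {x y} → Hom x y → Set ℓ
  isCatIso f = Sec f × Ret f

{-# OPTIONS --safe #-}
-- If f has a section g and a retraction r, then r = g, so g is a two-sided
-- inverse and post-composition f ∘_ and pre-composition _∘ f are equivalences
-- of hom-types. Sec f and Ret f are the fibres of these maps over id, and the
-- fibres of an equivalence are propositions once it is promoted to a
-- half-adjoint equivalence. Being a proposition whenever inhabited, isCatIso f
-- is a proposition.
module Submission where

open import Defs
open import Level using (Level)
open import Data.Product using (Σ; _×_; _,_)
open import Function.Bundles using (Inverse; _↔_; mk↔ₛ′)
open import Function.Properties.Inverse.HalfAdjointEquivalence using (_≃_; ↔⇒≃)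
open import Relation.Binary.PropositionalEquality
  using (_≡_; refl; sym; trans; cong; cong₂; module ≡-Reasoning)

private
  variable
    a b : Level
    A : Set a
    B : Set b

×-isProp : isProp A → isProp B → isProp (A × B)
×-isProp isPropA isPropB (x₁ , y₁) (x₂ , y₂) = cong₂ _,_ (isPropA x₁ x₂) (isPropB y₁ y₂)

Fibre : (A → B) → B → Set _
Fibre {A = A} f y = Σ A λ x → f x ≡ y

module _ (e : A ≃ B) where
  open _≃_ e

  private
    fibre-path : ∀ {x x′} (p : x′ ≡ x) → (x′ , cong to p) ≡ (x , refl {x = to x})
    fibre-path refl = refl

  -- The half-adjoint coherence identifies the centre (from (to x) , right-inverse-of (to x))
  -- with the image under cong to of left-inverse-of x, which contracts to (x , refl).
  fibre-≡-centre : ∀ {y} (u : Fibre to y) → u ≡ (from y , right-inverse-of y)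
  fibre-≡-centre (x , refl) =
    sym (trans (cong (from (to x) ,_) (sym (left-right x))) (fibre-path (left-inverse-of x)))

  ≃-fibre-isProp : ∀ y → isProp (Fibre to y)
  ≃-fibre-isProp y u v = trans (fibre-≡-centre u) (sym (fibre-≡-centre v))

↔-fibre-isProp : (e : A ↔ B) → ∀ y → isProp (Fibre (Inverse.to e) y)
↔-fibre-isProp e = ≃-fibre-isProp (↔⇒≃ e)

module _ {o ℓ} (C : WildCat o ℓ) where
  open WildCat C

  private
    variable
      w x y : Ob

  retraction≡section : {f : Hom x y} {g r : Hom y x} → f ∘ g ≡ id → r ∘ f ≡ id → r ≡ g
  retraction≡section {f = f} {g} {r} fg≡id rf≡id = begin
    r             ≡⟨ sym (idr r) ⟩
    r ∘ id        ≡⟨ cong (r ∘_) (sym fg≡id) ⟩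
    r ∘ (f ∘ g)   ≡⟨ sym (assoc r f g) ⟩
    (r ∘ f) ∘ g   ≡⟨ cong (_∘ g) rf≡id ⟩
    id ∘ g        ≡⟨ idl g ⟩
    g             ∎
    where open ≡-Reasoning

  section-isRetraction : {f : Hom x y} {g r : Hom y x} → f ∘ g ≡ id → r ∘ f ≡ id → g ∘ f ≡ id
  section-isRetraction {f = f} fg≡id rf≡id =
    trans (cong (_∘ f) (sym (retraction≡section fg≡id rf≡id))) rf≡id

  ∘-cancelˡ : {f : Hom x y} {g : Hom y x} → g ∘ f ≡ id → (h : Hom w x) → g ∘ (f ∘ h) ≡ h
  ∘-cancelˡ {f = f} {g} gf≡id h = trans (sym (assoc g f h)) (trans (cong (_∘ h) gf≡id) (idl h))

  ∘-cancelʳ : {f : Hom x y} {g : Hom y x} → g ∘ f ≡ id → (h : Hom x w) → (h ∘ g) ∘ f ≡ h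
  ∘-cancelʳ {f = f} {g} gf≡id h = trans (assoc h g f) (trans (cong (h ∘_) gf≡id) (idr h))

  postcomp-↔ : {f : Hom x y} {g : Hom y x} → f ∘ g ≡ id → g ∘ f ≡ id → Hom w x ↔ Hom w y
  postcomp-↔ {f = f} {g} fg≡id gf≡id = mk↔ₛ′ (f ∘_) (g ∘_) (∘-cancelˡ fg≡id) (∘-cancelˡ gf≡id)

  precomp-↔ : {f : Hom x y} {g : Hom y x} → f ∘ g ≡ id → g ∘ f ≡ id → Hom y w ↔ Hom x w
  precomp-↔ {f = f} {g} fg≡id gf≡id = mk↔ₛ′ (_∘ f) (_∘ g) (∘-cancelʳ gf≡id) (∘-cancelʳ fg≡id)

  isCatIso⇒Sec-isProp : (f : Hom x y) → isCatIso C f → isProp (Sec C f)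
  isCatIso⇒Sec-isProp f ((g , fg≡id) , (r , rf≡id)) =
    ↔-fibre-isProp (postcomp-↔ fg≡id (section-isRetraction fg≡id rf≡id)) id

  isCatIso⇒Ret-isProp : (f : Hom x y) → isCatIso C f → isProp (Ret C f)
  isCatIso⇒Ret-isProp f ((g , fg≡id) , (r , rf≡id)) =
    ↔-fibre-isProp (precomp-↔ fg≡id (section-isRetraction fg≡id rf≡id)) id

corollary2p7 : ∀ {o ℓ} (C : WildCat o ℓ) {x y : WildCat.Ob C} (f : WildCat.Hom C x y) →
    isProp (isCatIso C f)
corollary2p7 C f i = ×-isProp (isCatIso⇒Sec-isProp C f i) (isCatIso⇒Ret-isProp C f i) i
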